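{- Let $n\geq 1$. If $a_1,a_2,a_3\in\mathbb{Z}[X_{n-1}]$ satisfy $$a_1a_2+1=X_n^2(a_2a_3+1)\quad\text{and}\quad a_2^2-X_n^2(a_2a_3+1)^2=-1,$$ then $a_1a_2a_3+a_1+a_3=a_2$.
   Context: For $m\geq 0$ let $X_m=2\cos(2\pi/2^{m+2})$ (so $X_0=0$ and $X_m=\sqrt{2+X_{m-1}}$); $\mathbb{Z}[X_m]$ is the ring of integers of $\mathbb{Q}(X_m)$. -}

module Defs where

open import Data.Nat using (ℕ; zero; suc)
open import Data.Integer using (ℤ; +_)
import Data.Integer as ℤ
open import Data.Product using (_×_; _,_)

-- Concrete model of the ring ℤ[X_m], X_0 = 0, X_m = √(2 + X_{m-1}).
-- ℤ[X_0] = ℤ, and ℤ[X_{m+1}] = ℤ[X_m] ⊕ ℤ[X_m]·X_{m+1} (free of rank 2,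
-- since X_{m+1}² = 2 + X_m and [ℚ(X_{m+1}) : ℚ(X_m)] = 2).
-- A pair (a , b) : R (suc m) stands for a + b·X_{m+1}.
R : ℕ → Set
R zero    = ℤ
R (suc m) = R m × R m

ι : ∀ {m} → ℤ → R m
ι {zero}  k = k
ι {suc m} k = (ι k , ι (+ 0))

0R 1R : ∀ {m} → R m
0R = ι (+ 0)
1R = ι (+ 1)

X : (m : ℕ) → R m
X zero    = + 0
X (suc m) = (0R , 1R)

infixl 6 _⊕_ _⊖_
infixl 7 _⊗_
infix  8 ⊖_

_⊕_ : ∀ {m} → R m → R m → R m
_⊕_ {zero}  a b = a ℤ.+ b
_⊕_ {suc m} (a , b) (c , d) = (a ⊕ c , b ⊕ d)

⊖_ : ∀ {m} → R m → R m
⊖_ {zero}  a = ℤ.- a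
⊖_ {suc m} (a , b) = (⊖ a , ⊖ b)

_⊖_ : ∀ {m} → R m → R m → R m
a ⊖ b = a ⊕ (⊖ b)

-- (a + b X)(c + d X) = (ac + bd X²) + (ad + bc) X, with X_{m+1}² = 2 + X_m
_⊗_ : ∀ {m} → R m → R m → R m
_⊗_ {zero}  a b = a ℤ.* b
_⊗_ {suc m} (a , b) (c , d) =
  (a ⊗ c ⊕ (b ⊗ d) ⊗ (ι (+ 2) ⊕ X m) , a ⊗ d ⊕ b ⊗ c)

incl : ∀ {m} → R m → R (suc m)
incl a = (a , 0R)

-- Write c = a₂a₃ + 1, w = X_n² = 2 + X_{n-1} and D = (a₁a₂a₃ + a₁ + a₃) − a₂.
-- Multiplying the first equation by c and comparing with the second gives
-- a₂D = 0.  Hence cD = D and (a₁a₂ + 1)D = D, and as a₁a₂ + 1 = wc also wD = D.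
-- But w − 1 = 1 + X_{n-1} is a unit of ℤ[X_{n-1}], so D = 0.
module Submission where

open import Defs
open import Data.Nat using (ℕ; suc)
open import Data.Integer using (+_; -[1+_])
open import Relation.Binary.PropositionalEquality using (_≡_)

open import Algebra.Bundles using (CommutativeRing)
open import Algebra.Core using (Op₁; Op₂)
open import Algebra.Structures using (IsCommutativeRing)
open import Data.Nat using (zero)
open import Data.Product using (_,_; proj₁)
open import Level using (0ℓ)
open import Relation.Binary.PropositionalEquality as ≡
  using (cong; cong₂; isEquivalence; module ≡-Reasoning)

module CommutativeRingProperties {r ℓ} (R : CommutativeRing r ℓ) where

  open CommutativeRing R
  open import Algebra.Properties.Ring ring
  open import Algebra.Solver.Ring.NaturalCoefficients.Default commutativeSemiring
  open import Relation.Binary.Reasoning.Setoid setoid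

  x-y≈-1⇒x+1≈y : ∀ {x y} → x - y ≈ - 1# → x + 1# ≈ y
  x-y≈-1⇒x+1≈y {x} {y} x-y≈-1 = x∙y⁻¹≈ε⇒x≈y (x + 1#) y (begin
    x + 1# - y     ≈⟨ solve 2 (λ x n → x :+ con 1 :+ n := x :+ n :+ con 1) refl x (- y) ⟩
    x - y + 1#     ≈⟨ +-congʳ x-y≈-1 ⟩
    - 1# + 1#      ≈⟨ -‿inverseˡ 1# ⟩
    0#             ∎)

  xz≈0⇒[xy+1]z≈z : ∀ {x y z} → x * z ≈ 0# → (x * y + 1#) * z ≈ z
  xz≈0⇒[xy+1]z≈z {x} {y} {z} xz≈0 = begin
    (x * y + 1#) * z   ≈⟨ solve 3 (λ x y z → (x :* y :+ con 1) :* z := y :* (x :* z) :+ z) refl x y z ⟩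
    y * (x * z) + z    ≈⟨ +-congʳ (*-congˡ xz≈0) ⟩
    y * 0# + z         ≈⟨ +-congʳ (zeroʳ y) ⟩
    0# + z             ≈⟨ +-identityˡ z ⟩
    z                  ∎

  u[w-1]≈1∧wz≈z⇒z≈0 : ∀ {u w z} → u * (w - 1#) ≈ 1# → w * z ≈ z → z ≈ 0#
  u[w-1]≈1∧wz≈z⇒z≈0 {u} {w} {z} u[w-1]≈1 wz≈z = begin
    z                    ≈⟨ *-identityˡ z ⟨
    1# * z               ≈⟨ *-congʳ u[w-1]≈1 ⟨
    u * (w - 1#) * z     ≈⟨ *-assoc u (w - 1#) z ⟩
    u * ((w - 1#) * z)   ≈⟨ *-congˡ ([y-z]x≈yx-zx z w 1#) ⟩
    u * (w * z - 1# * z) ≈⟨ *-congˡ (+-cong wz≈z (-‿cong (*-identityˡ z))) ⟩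
    u * (z - z)          ≈⟨ *-congˡ (-‿inverseʳ z) ⟩
    u * 0#               ≈⟨ zeroʳ u ⟩
    0#                   ∎

  a₁a₂a₃+a₁+a₃≈a₂ : ∀ {u w a₁ a₂ a₃} → u * (w - 1#) ≈ 1# →
    a₁ * a₂ + 1# ≈ w * (a₂ * a₃ + 1#) →
    a₂ * a₂ - w * ((a₂ * a₃ + 1#) * (a₂ * a₃ + 1#)) ≈ - 1# →
    a₁ * a₂ * a₃ + a₁ + a₃ ≈ a₂
  a₁a₂a₃+a₁+a₃≈a₂ {u} {w} {a₁} {a₂} {a₃} u[w-1]≈1 e₁ e₂ =
    x∙y⁻¹≈ε⇒x≈y G a₂ (u[w-1]≈1∧wz≈z⇒z≈0 u[w-1]≈1 wD≈D)
    where
    c G D : Carrier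
    c = a₂ * a₃ + 1#
    G = a₁ * a₂ * a₃ + a₁ + a₃
    D = G - a₂

    a₂G≈a₂a₂ : a₂ * G ≈ a₂ * a₂
    a₂G≈a₂a₂ = +-cancelʳ 1# (a₂ * G) (a₂ * a₂) (begin
      a₂ * G + 1#          ≈⟨ solve 3 (λ a₁ a₂ a₃ →
                                a₂ :* (a₁ :* a₂ :* a₃ :+ a₁ :+ a₃) :+ con 1
                                := (a₂ :* a₃ :+ con 1) :* (a₁ :* a₂ :+ con 1)) refl a₁ a₂ a₃ ⟩
      c * (a₁ * a₂ + 1#)   ≈⟨ *-congˡ e₁ ⟩
      c * (w * c)          ≈⟨ solve 2 (λ c w → c :* (w :* c) := w :* (c :* c)) refl c w ⟩
      w * (c * c)          ≈⟨ x-y≈-1⇒x+1≈y e₂ ⟨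
      a₂ * a₂ + 1#         ∎)

    a₂D≈0 : a₂ * D ≈ 0#
    a₂D≈0 = trans (x[y-z]≈xy-xz a₂ G a₂) (x≈y⇒x∙y⁻¹≈ε a₂G≈a₂a₂)

    wD≈D : w * D ≈ D
    wD≈D = begin
      w * D                ≈⟨ *-congˡ (xz≈0⇒[xy+1]z≈z a₂D≈0) ⟨
      w * (c * D)          ≈⟨ *-assoc w c D ⟨
      w * c * D            ≈⟨ *-congʳ e₁ ⟨
      (a₁ * a₂ + 1#) * D   ≈⟨ *-congʳ (+-congʳ (*-comm a₁ a₂)) ⟩
      (a₂ * a₁ + 1#) * D   ≈⟨ xz≈0⇒[xy+1]z≈z a₂D≈0 ⟩
      D                    ∎

module _ {a} {A : Set a} where

  open import Algebra.Definitions (_≡_ {A = A})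
  open import Algebra.Consequences.Propositional {A = A}

  record CommutativeRingLaws (_+_ _*_ : Op₂ A) (-_ : Op₁ A) (0# 1# : A) : Set a where
    field
      +-assoc     : Associative _+_
      +-comm      : Commutative _+_
      +-identityˡ : LeftIdentity 0# _+_
      -‿inverseˡ  : LeftInverse 0# -_ _+_
      *-assoc     : Associative _*_
      *-comm      : Commutative _*_
      *-identityˡ : LeftIdentity 1# _*_
      distribʳ    : _*_ DistributesOverʳ _+_

    isCommutativeRing : IsCommutativeRing _≡_ _+_ _*_ -_ 0# 1#
    isCommutativeRing = record
      { isRing = record
        { +-isAbelianGroup = record
          { isGroup = record
            { isMonoid = record
              { isSemigroup = record
                { isMagma = record { isEquivalence = isEquivalence ; ∙-cong = cong₂ _+_ }
                ; assoc = +-assoc }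
              ; identity = comm∧idˡ⇒id +-comm +-identityˡ }
            ; inverse = comm∧invˡ⇒inv +-comm -‿inverseˡ
            ; ⁻¹-cong = cong -_ }
          ; comm = +-comm }
        ; *-cong = cong₂ _*_
        ; *-assoc = *-assoc
        ; *-identity = comm∧idˡ⇒id *-comm *-identityˡ
        ; distrib = comm∧distrʳ⇒distrˡ *-comm distribʳ , distribʳ }
      ; *-comm = *-comm }

    commutativeRing : CommutativeRing a a
    commutativeRing = record { isCommutativeRing = isCommutativeRing }

commutativeRingLaws : ∀ m → CommutativeRingLaws {A = R m} _⊕_ _⊗_ ⊖_ 0R 1R
commutativeRingLaws zero = record
  { +-assoc = ℤ.+-assoc ; +-comm = ℤ.+-comm ; +-identityˡ = ℤ.+-identityˡ ; -‿inverseˡ = ℤ.+-inverseˡ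
  ; *-assoc = ℤ.*-assoc ; *-comm = ℤ.*-comm ; *-identityˡ = ℤ.*-identityˡ ; distribʳ = ℤ.*-distribʳ-+ }
  where import Data.Integer.Properties as ℤ
commutativeRingLaws (suc m) = record
  { +-assoc = λ (a , b) (c , d) (e , f) → cong₂ _,_ (+-assoc a c e) (+-assoc b d f)
  ; +-comm = λ (a , b) (c , d) → cong₂ _,_ (+-comm a c) (+-comm b d)
  ; +-identityˡ = λ (a , b) → cong₂ _,_ (+-identityˡ a) (+-identityˡ b)
  ; -‿inverseˡ = λ (a , b) → cong₂ _,_ (-‿inverseˡ a) (-‿inverseˡ b)
  ; *-assoc = λ (a , b) (c , d) (e , f) → cong₂ _,_
      (solve 7 (λ a b c d e f w →
         (a :* c :+ b :* d :* w) :* e :+ (a :* d :+ b :* c) :* f :* w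
         := a :* (c :* e :+ d :* f :* w) :+ b :* (c :* f :+ d :* e) :* w) refl a b c d e f w)
      (solve 7 (λ a b c d e f w →
         (a :* c :+ b :* d :* w) :* f :+ (a :* d :+ b :* c) :* e
         := a :* (c :* f :+ d :* e) :+ b :* (c :* e :+ d :* f :* w)) refl a b c d e f w)
  ; *-comm = λ (a , b) (c , d) → cong₂ _,_
      (solve 5 (λ a b c d w → a :* c :+ b :* d :* w := c :* a :+ d :* b :* w) refl a b c d w)
      (solve 4 (λ a b c d → a :* d :+ b :* c := c :* b :+ d :* a) refl a b c d)
  ; *-identityˡ = λ (a , b) → cong₂ _,_
      (solve 3 (λ a b w → con 1 :* a :+ con 0 :* b :* w := a) refl a b w)
      (solve 2 (λ a b → con 1 :* b :+ con 0 :* a := b) refl a b)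
  ; distribʳ = λ (a , b) (c , d) (e , f) → cong₂ _,_
      (solve 7 (λ a b c d e f w →
         (c :+ e) :* a :+ (d :+ f) :* b :* w
         := c :* a :+ d :* b :* w :+ (e :* a :+ f :* b :* w)) refl a b c d e f w)
      (solve 6 (λ a b c d e f →
         (c :+ e) :* b :+ (d :+ f) :* a := c :* b :+ d :* a :+ (e :* b :+ f :* a)) refl a b c d e f)
  }
  where
  open CommutativeRing (CommutativeRingLaws.commutativeRing (commutativeRingLaws m))
  open import Algebra.Solver.Ring.NaturalCoefficients.Default commutativeSemiring
  w : R m
  w = ι (+ 2) ⊕ X m

commutativeRing : ℕ → CommutativeRing 0ℓ 0ℓ
commutativeRing m = CommutativeRingLaws.commutativeRing (commutativeRingLaws m)

ι2≡1+1 : ∀ m → ι {m} (+ 2) ≡ 1R ⊕ 1R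
ι2≡1+1 zero    = ≡.refl
ι2≡1+1 (suc m) = cong₂ _,_ (ι2≡1+1 m) (sym (+-identityˡ 0R))
  where open CommutativeRing (commutativeRing m)

ι-1≡-1 : ∀ m → ι {m} -[1+ 0 ] ≡ ⊖ 1R
ι-1≡-1 zero    = ≡.refl
ι-1≡-1 (suc m) = cong₂ _,_ (ι-1≡-1 m) (≡.sym -0#≈0#)
  where open import Algebra.Properties.Ring (CommutativeRing.ring (commutativeRing m))

X²-incl : ∀ m y → (X (suc m) ⊗ X (suc m)) ⊗ incl y ≡ incl ((ι (+ 2) ⊕ X m) ⊗ y)
X²-incl m y = cong₂ _,_
  (solve 2 (λ w y → (con 0 :* con 0 :+ con 1 :* con 1 :* w) :* y
                    :+ (con 0 :* con 1 :+ con 1 :* con 0) :* con 0 :* w := w :* y) refl w y)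
  (solve 2 (λ w y → (con 0 :* con 0 :+ con 1 :* con 1 :* w) :* con 0
                    :+ (con 0 :* con 1 :+ con 1 :* con 0) :* y := con 0) refl w y)
  where
  open CommutativeRing (commutativeRing m)
  open import Algebra.Solver.Ring.NaturalCoefficients.Default commutativeSemiring
  w : R m
  w = ι (+ 2) ⊕ X m

-- [1+X]⁻¹ (m + 1) = (X_{m+1} − 1) · [1+X]⁻¹ m, as (1 + X_{m+1})(X_{m+1} − 1) = X_{m+1}² − 1 = 1 + X_m.
[1+X]⁻¹ : ∀ m → R m
[1+X]⁻¹ zero    = + 1
[1+X]⁻¹ (suc m) = (⊖ [1+X]⁻¹ m , [1+X]⁻¹ m)

[1+X]⁻¹-inverseˡ : ∀ m → [1+X]⁻¹ m ⊗ (1R ⊕ X m) ≡ 1R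
[1+X]⁻¹-inverseˡ zero    = ≡.refl
[1+X]⁻¹-inverseˡ (suc m) = cong₂ _,_ first second
  where
  open CommutativeRing (commutativeRing m)
  open import Algebra.Solver.Ring.NaturalCoefficients.Default commutativeSemiring
  open ≡-Reasoning
  u : R m
  u = [1+X]⁻¹ m

  first : ⊖ u ⊗ (1R ⊕ 0R) ⊕ u ⊗ (0R ⊕ 1R) ⊗ (ι (+ 2) ⊕ X m) ≡ 1R
  first = begin
    ⊖ u ⊗ (1R ⊕ 0R) ⊕ u ⊗ (0R ⊕ 1R) ⊗ (ι (+ 2) ⊕ X m)
      ≡⟨ cong (λ t → ⊖ u ⊗ (1R ⊕ 0R) ⊕ u ⊗ (0R ⊕ 1R) ⊗ (t ⊕ X m)) (ι2≡1+1 m) ⟩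
    ⊖ u ⊗ (1R ⊕ 0R) ⊕ u ⊗ (0R ⊕ 1R) ⊗ (1R ⊕ 1R ⊕ X m)
      ≡⟨ solve 3 (λ v u x → v :* (con 1 :+ con 0) :+ u :* (con 0 :+ con 1) :* (con 1 :+ con 1 :+ x)
                            := v :+ (u :+ u :* (con 1 :+ x))) refl (⊖ u) u (X m) ⟩
    ⊖ u ⊕ (u ⊕ u ⊗ (1R ⊕ X m))
      ≡⟨ cong (λ t → ⊖ u ⊕ (u ⊕ t)) ([1+X]⁻¹-inverseˡ m) ⟩
    ⊖ u ⊕ (u ⊕ 1R)
      ≡⟨ +-assoc (⊖ u) u 1R ⟨
    ⊖ u ⊕ u ⊕ 1R
      ≡⟨ cong (_⊕ 1R) (-‿inverseˡ u) ⟩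
    0R ⊕ 1R
      ≡⟨ +-identityˡ 1R ⟩
    1R ∎

  second : ⊖ u ⊗ (0R ⊕ 1R) ⊕ u ⊗ (1R ⊕ 0R) ≡ 0R
  second = begin
    ⊖ u ⊗ (0R ⊕ 1R) ⊕ u ⊗ (1R ⊕ 0R)
      ≡⟨ solve 2 (λ v u → v :* (con 0 :+ con 1) :+ u :* (con 1 :+ con 0) := v :+ u) refl (⊖ u) u ⟩
    ⊖ u ⊕ u
      ≡⟨ -‿inverseˡ u ⟩
    0R ∎

2+X-1≡1+X : ∀ m → ι (+ 2) ⊕ X m ⊖ 1R ≡ 1R ⊕ X m
2+X-1≡1+X m = begin
  ι (+ 2) ⊕ X m ⊖ 1R        ≡⟨ cong (λ t → t ⊕ X m ⊖ 1R) (ι2≡1+1 m) ⟩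
  1R ⊕ 1R ⊕ X m ⊖ 1R        ≡⟨ solve 2 (λ x n → con 1 :+ con 1 :+ x :+ n := con 1 :+ x :+ (con 1 :+ n))
                                  refl (X m) (⊖ 1R) ⟩
  1R ⊕ X m ⊕ (1R ⊖ 1R)      ≡⟨ cong (1R ⊕ X m ⊕_) (-‿inverseʳ 1R) ⟩
  1R ⊕ X m ⊕ 0R             ≡⟨ +-identityʳ (1R ⊕ X m) ⟩
  1R ⊕ X m                  ∎
  where
  open CommutativeRing (commutativeRing m)
  open import Algebra.Solver.Ring.NaturalCoefficients.Default commutativeSemiring
  open ≡-Reasoning

lemma3p2 : (m : ℕ) (a₁ a₂ a₃ : R m)
    → incl (a₁ ⊗ a₂ ⊕ 1R) ≡ (X (suc m) ⊗ X (suc m)) ⊗ incl (a₂ ⊗ a₃ ⊕ 1R)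
    → incl (a₂ ⊗ a₂) ⊖ (X (suc m) ⊗ X (suc m)) ⊗ incl ((a₂ ⊗ a₃ ⊕ 1R) ⊗ (a₂ ⊗ a₃ ⊕ 1R)) ≡ ι -[1+ 0 ]
    → a₁ ⊗ a₂ ⊗ a₃ ⊕ a₁ ⊕ a₃ ≡ a₂
lemma3p2 m a₁ a₂ a₃ h₁ h₂ = a₁a₂a₃+a₁+a₃≈a₂ [1+X]⁻¹-inverts-w-1 e₁ e₂
  where
  open CommutativeRing (commutativeRing m)
  open CommutativeRingProperties (commutativeRing m)
  w c : R m
  w = ι (+ 2) ⊕ X m
  c = a₂ ⊗ a₃ ⊕ 1R

  [1+X]⁻¹-inverts-w-1 : [1+X]⁻¹ m ⊗ (w ⊖ 1R) ≡ 1R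
  [1+X]⁻¹-inverts-w-1 = trans (cong ([1+X]⁻¹ m ⊗_) (2+X-1≡1+X m)) ([1+X]⁻¹-inverseˡ m)

  e₁ : a₁ ⊗ a₂ ⊕ 1R ≡ w ⊗ c
  e₁ = cong proj₁ (≡.trans h₁ (X²-incl m c))

  e₂ : a₂ ⊗ a₂ ⊖ w ⊗ (c ⊗ c) ≡ ⊖ 1R
  e₂ = trans (cong (λ z → a₂ ⊗ a₂ ⊖ proj₁ z) (≡.sym (X²-incl m (c ⊗ c))))
             (trans (cong proj₁ h₂) (ι-1≡-1 m))
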